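{- Let $n,k$ be positive integers and let $\pi$ be a function assigning to each size-$n$ multiset $S$ of $[k]$ a permutation (string) $\pi(S)$ of $S$, with maximum distortion at most $3$. For a set $R\subseteq[k]$ let $\mathcal U_R$ denote the family of all sets $S\subseteq[k]$ with $R\subset S$ and $|S|=|R|+1$. Then every set $R\subset[k]$ with $|R|=n-1$ satisfies at least one of the following: (1) there exist $A_R\subset R$ with $|A_R|=n-3$ and a one-to-one map $g_R:A_R\to[n]$ such that $\pi(S)[g_R(a)]=a$ for all $a\in A_R$ and all $S\in\mathcal U_R$; (2) there exist a one-to-one map $h_R:R\to[n]$ and an index $w_R\in[n]$ (the unique index not in the image of $h_R$) such that for every $r\in R$ and every $S\in\mathcal U_R$, either $\pi(S)[h_R(r)]=r$ or $\pi(S)[w_R]=r$.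
   Context: For multisets $S,S'$, $S\oplus S'$ is the multiset symmetric difference. For strings $X,Y$ of equal length $n$, $d(X,Y)$ is the Hamming distance and $X[i]$ ($i\in[n]$) is the $i$-th character. The maximum distortion of $\pi$ is the maximum of $d(\pi(S),\pi(S'))$ over all pairs of size-$n$ multisets $S,S'$ of $[k]$ with $|S\oplus S'|=2$. -}

module Defs where

open import Data.Nat using (ℕ; _+_; _≤_; ∣_-_∣)
open import Data.Bool using (if_then_else_)
open import Data.Fin using (Fin; _≟_)
open import Data.List using (List; length; filter; map; allFin)
open import Data.Nat.ListAction using (sum)
open import Data.Product using (_×_)
open import Data.Vec using (lookup)
open import Data.Fin.Subset using (Subset; _⊂_; ∣_∣)
open import Relation.Nullary using (¬?)
open import Relation.Binary.PropositionalEquality using (_≡_)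

Multiset : ℕ → Set
Multiset k = Fin k → ℕ

size : ∀ {k} → Multiset k → ℕ
size {k} S = sum (map S (allFin k))

symDiff : ∀ {k} → Multiset k → Multiset k → ℕ
symDiff {k} S S' = sum (map (λ i → ∣ S i - S' i ∣) (allFin k))

String : ℕ → ℕ → Set
String n k = Fin n → Fin k

occ : ∀ {n k} → String n k → Fin k → ℕ
occ {n} X i = length (filter (λ j → X j ≟ i) (allFin n))

IsPermOf : ∀ {n k} → String n k → Multiset k → Set
IsPermOf X S = ∀ i → occ X i ≡ S i

hamming : ∀ {n k} → String n k → String n k → ℕ
hamming {n} X Y = length (filter (λ j → ¬? (X j ≟ Y j)) (allFin n))

-- π assigns to every size-n multiset of [k] a permutation of it
-- (its values on multisets of other sizes are irrelevant)
IsAssignment : ∀ n k → (Multiset k → String n k) → Set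
IsAssignment n k π = ∀ S → size S ≡ n → IsPermOf (π S) S

MaxDistortionAtMost : ∀ n k → (Multiset k → String n k) → ℕ → Set
MaxDistortionAtMost n k π d =
  ∀ S S' → size S ≡ n → size S' ≡ n → symDiff S S' ≡ 2 →
  hamming (π S) (π S') ≤ d

toMultiset : ∀ {k} → Subset k → Multiset k
toMultiset S i = if lookup S i then 1 else 0

InU : ∀ {k} → Subset k → Subset k → Set
InU R S = (R ⊂ S) × (∣ S ∣ ≡ ∣ R ∣ + 1)

module Submission where

-- For x ∉ R let σ x be the arrangement π (R ∪ ⁅ x ⁆), a bijection from the
-- positions onto R ∪ ⁅ x ⁆.  The sets R ∪ ⁅ x ⁆ and R ∪ ⁅ y ⁆ have symmetric
-- difference 2, so σ x and σ y differ in at most three positions.  Fix x₀ ∉ R;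
-- every letter of R has a position pos r in σ x₀, and x₀ sits at the spare
-- position.  If no σ u misplaces two letters of R, every letter is in place or
-- at the spare position: alternative (2).  Otherwise some σ y misplaces a and b,
-- and comparing it with σ x₀ shows that it either swaps a and b or moves them
-- cyclically through the spare position.  After a swap no arrangement can
-- misplace any other letter, which is alternative (1) for A = R ∖ {a, b}.
-- After a cycle the same holds unless some σ z misplaces a third letter c; then
-- comparing any σ u with σ x₀, σ y and σ z shows that either σ u puts a at the
-- spare position, or it puts a at pos a and every other letter in place.  This
-- is alternative (2) with a sent to the spare position and w = pos a.

open import Defs
open import Data.Bool using (Bool; true; false; if_then_else_)
open import Data.Empty using (⊥; ⊥-elim)
open import Data.Fin using (Fin; zero; suc; _≟_; inject₁; fromℕ)
open import Data.Fin.Properties using (any?; inject₁-injective; fromℕ≢inject₁)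
open import Data.Fin.Subset
  using (Subset; inside; outside; _∈_; _∉_; _⊆_; _⊂_; _∪_; ⁅_⁆; ⊤; ∣_∣)
  renaming (_-_ to _∖_; ⊥ to ∅)
open import Data.Fin.Subset.Properties
  using (_∈?_; ∉⊥; x∈⁅x⁆; x∈⁅y⁆⇒x≡y; x≢y⇒x∉⁅y⁆; ∣⁅x⁆∣≡1; ∣p∣≤n; ∣⊤∣≡n; ∪-identityʳ;
         x∈p∪q⁻; x∈p∪q⁺; p⊆p∪q; p─q⊆p; p─⊥≡p; ⊆-antisym; p⊆q⇒∣p∣≤∣q∣; p⊂q⇒∣p∣<∣q∣)
  renaming (x∈p∧x≢y⇒x∈p-y to x∈p∧x≢y⇒x∈p∖y)
open import Data.List using (List; []; _∷_; length; filter; map; allFin; tabulate)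
open import Data.List.Properties using (map-tabulate)
open import Data.List.Relation.Unary.All using (All; []; _∷_)
import Data.List.Relation.Unary.All as All
open import Data.List.Relation.Unary.Unique.Propositional using (Unique; []; _∷_)
open import Data.Nat using (ℕ; zero; suc; _+_; _≤_; s≤s; z≤n; ∣_-_∣)
open import Data.Nat.ListAction using (sum)
open import Data.Nat.Properties
  using (+-0-commutativeMonoid; +-comm; +-identityʳ; ≤-trans; ≤-antisym; <-≤-trans;
         suc-injective; n≮n; ∣m+n-m+o∣≡∣n-o∣; ∣-∣-identityˡ)
open import Algebra.Properties.CommutativeMonoid.Sum +-0-commutativeMonoid
  using (sum-cong-≗; ∑-distrib-+)
  renaming (sum to ∑)
open import Data.Product using (Σ; ∃; _×_; _,_; proj₁; proj₂)
open import Data.Sum using (_⊎_; inj₁; inj₂)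
import Data.Sum as Sum
open import Data.Vec using (lookup; here; there)
import Data.Vec as Vec
open import Data.Vec.Properties using ([]=⇒lookup; lookup⇒[]=)
open import Function using (_∘_; _$_)
open import Relation.Nullary using (¬_; Dec; yes; no; does; ¬?; contradiction)
open import Relation.Nullary.Decidable using (_×-dec_; decidable-stable)
open import Relation.Unary using (Pred; Decidable)
open import Relation.Binary.PropositionalEquality
  using (_≡_; _≢_; refl; sym; trans; cong; cong₂; subst; ≢-sym; module ≡-Reasoning)

𝟙 : Bool → ℕ
𝟙 b = if b then 1 else 0

𝟙≤1 : ∀ b → 𝟙 b ≤ 1
𝟙≤1 true  = s≤s z≤n
𝟙≤1 false = z≤n

sum-map-allFin : ∀ {m} (f : Fin m → ℕ) → sum (map f (allFin m)) ≡ ∑ f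
sum-map-allFin {m} f = trans (cong sum (map-tabulate (λ i → i) f)) (sum-tabulate f)
  where
  sum-tabulate : ∀ {m} (g : Fin m → ℕ) → sum (tabulate g) ≡ ∑ g
  sum-tabulate {zero}  g = refl
  sum-tabulate {suc m} g = cong (g zero +_) (sum-tabulate (g ∘ suc))

length-filter-allFin : ∀ {m p} {P : Pred (Fin m) p} (P? : Decidable P) →
  length (filter P? (allFin m)) ≡ ∑ (λ j → 𝟙 (does (P? j)))
length-filter-allFin {m} P? =
  trans (length-filter≡sum (allFin m)) (sum-map-allFin (λ j → 𝟙 (does (P? j))))
  where
  length-filter≡sum : ∀ xs → length (filter P? xs) ≡ sum (map (λ j → 𝟙 (does (P? j))) xs)
  length-filter≡sum []       = refl
  length-filter≡sum (x ∷ xs) with does (P? x)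
  ... | true  = cong suc (length-filter≡sum xs)
  ... | false = length-filter≡sum xs

filter-nonempty : ∀ {a p} {A : Set a} {P : Pred A p} (P? : Decidable P) {xs : List A} →
  1 ≤ length (filter P? xs) → ∃ P
filter-nonempty P? {x ∷ xs} nonempty with P? x
... | yes px = x , px
... | no  _  = filter-nonempty P? {xs} nonempty

toMultiset-∈ : ∀ {k} {S : Subset k} {i} → i ∈ S → toMultiset S i ≡ 1
toMultiset-∈ i∈S rewrite []=⇒lookup i∈S = refl

toMultiset-∉ : ∀ {k} {S : Subset k} {i} → i ∉ S → toMultiset S i ≡ 0
toMultiset-∉ {S = S} {i} i∉S with lookup S i in eq
... | true  = contradiction (lookup⇒[]= i S eq) i∉S
... | false = refl

toMultiset⇒∈ : ∀ {k} {S : Subset k} {i} → 1 ≤ toMultiset S i → i ∈ S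
toMultiset⇒∈ {S = S} {i} positive with lookup S i in eq
... | true = lookup⇒[]= i S eq

∑-toMultiset : ∀ {k} (S : Subset k) → ∑ (toMultiset S) ≡ ∣ S ∣
∑-toMultiset Vec.[]          = refl
∑-toMultiset (inside  Vec.∷ S) = cong suc (∑-toMultiset S)
∑-toMultiset (outside Vec.∷ S) = ∑-toMultiset S

∑-toMultiset-⁅⁆ : ∀ {k} (x : Fin k) → ∑ (toMultiset ⁅ x ⁆) ≡ 1
∑-toMultiset-⁅⁆ x = trans (∑-toMultiset ⁅ x ⁆) (∣⁅x⁆∣≡1 x)

count-remove : ∀ {m p} {P : Pred (Fin m) p} (P? : Decidable P) {x} → P x →
  ∑ (λ j → 𝟙 (does (P? j))) ≡ suc (∑ (λ j → 𝟙 (does ((P? j) ×-dec ¬? (j ≟ x)))))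
count-remove {m} P? {x} px = begin
  ∑ (λ j → 𝟙 (does (P? j)))                               ≡⟨ sum-cong-≗ split ⟩
  ∑ (λ j → toMultiset ⁅ x ⁆ j + 𝟙 (does (P′? j)))          ≡⟨ ∑-distrib-+ (toMultiset ⁅ x ⁆) _ ⟩
  ∑ (toMultiset ⁅ x ⁆) + ∑ (λ j → 𝟙 (does (P′? j)))       ≡⟨ cong (_+ ∑ (λ j → 𝟙 (does (P′? j)))) (∑-toMultiset-⁅⁆ x) ⟩
  suc (∑ (λ j → 𝟙 (does (P′? j))))                        ∎
  where
  open ≡-Reasoning
  P′? = λ j → P? j ×-dec ¬? (j ≟ x)
  split : ∀ j → 𝟙 (does (P? j)) ≡ toMultiset ⁅ x ⁆ j + 𝟙 (does (P′? j))
  split j with j ≟ x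
  ... | yes refl rewrite toMultiset-∈ (x∈⁅x⁆ x) with P? j
  ...   | yes _  = refl
  ...   | no ¬px = contradiction px ¬px
  split j | no j≢x rewrite toMultiset-∉ (x≢y⇒x∉⁅y⁆ j≢x) with P? j
  ...   | yes _ = refl
  ...   | no _  = refl

distinct≤count : ∀ {m p} {P : Pred (Fin m) p} (P? : Decidable P) {xs : List (Fin m)} →
  Unique xs → All P xs → length xs ≤ length (filter P? (allFin m))
distinct≤count P? unique pxs = subst (_ ≤_) (sym (length-filter-allFin P?)) (go P? unique pxs)
  where
  go : ∀ {m p} {P : Pred (Fin m) p} (P? : Decidable P) {xs} →
       Unique xs → All P xs → length xs ≤ ∑ (λ j → 𝟙 (does (P? j)))
  go P? {[]}     []              []         = z≤n
  go P? {x ∷ xs} (x≢xs ∷ unique) (px ∷ pxs) =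
    subst (_ ≤_) (sym (count-remove P? px))
      (s≤s (go (λ j → P? j ×-dec ¬? (j ≟ x)) unique
               (All.zipWith (λ (py , x≢y) → py , ≢-sym x≢y) (pxs , x≢xs))))

module _ {n k} {X : String n k} {S : Subset k} (perm : IsPermOf X (toMultiset S)) where

  perm-injective : ∀ {i j} → X i ≡ X j → i ≡ j
  perm-injective {i} {j} Xi≡Xj with i ≟ j
  ... | yes i≡j = i≡j
  ... | no  i≢j = contradiction (≤-trans two≤occ occ≤1) λ { (s≤s ()) }
    where
    two≤occ : 2 ≤ occ X (X j)
    two≤occ = distinct≤count (λ l → X l ≟ X j) ((i≢j ∷ []) ∷ [] ∷ []) (Xi≡Xj ∷ refl ∷ [])
    occ≤1 : occ X (X j) ≤ 1
    occ≤1 = subst (_≤ 1) (sym (perm (X j))) (𝟙≤1 (lookup S (X j)))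

  perm-∈ : ∀ j → X j ∈ S
  perm-∈ j = toMultiset⇒∈ (subst (1 ≤_) (perm (X j))
    (distinct≤count (λ l → X l ≟ X j) ([] ∷ []) (refl ∷ [])))

  perm-surjective : ∀ {i} → i ∈ S → ∃ λ j → X j ≡ i
  perm-surjective {i} i∈S = filter-nonempty (λ j → X j ≟ i) {allFin n}
    (subst (1 ≤_) (sym (trans (perm i) (toMultiset-∈ i∈S))) (s≤s z≤n))

toMultiset-∪⁅⁆ : ∀ {k} {R : Subset k} {x} → x ∉ R →
  ∀ i → toMultiset (R ∪ ⁅ x ⁆) i ≡ toMultiset R i + toMultiset ⁅ x ⁆ i
toMultiset-∪⁅⁆ {R = outside Vec.∷ R} {zero}  x∉R zero    = refl
toMultiset-∪⁅⁆ {R = inside  Vec.∷ R} {zero}  x∉R zero    = contradiction here x∉R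
toMultiset-∪⁅⁆ {R = s Vec.∷ R}       {zero}  x∉R (suc i)
  rewrite ∪-identityʳ R | toMultiset-∉ {S = ∅} {i} ∉⊥ = sym (+-identityʳ _)
toMultiset-∪⁅⁆ {R = inside  Vec.∷ R} {suc x} x∉R zero    = refl
toMultiset-∪⁅⁆ {R = outside Vec.∷ R} {suc x} x∉R zero    = refl
toMultiset-∪⁅⁆ {R = s Vec.∷ R}       {suc x} x∉R (suc i) =
  toMultiset-∪⁅⁆ (x∉R ∘ there) i

module _ {k} {R : Subset k} where

  size-∪⁅⁆ : ∀ {x} → x ∉ R → size (toMultiset (R ∪ ⁅ x ⁆)) ≡ ∣ R ∣ + 1
  size-∪⁅⁆ {x} x∉R = begin
    size (toMultiset (R ∪ ⁅ x ⁆))                    ≡⟨ sum-map-allFin {k} _ ⟩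
    ∑ (toMultiset (R ∪ ⁅ x ⁆))                       ≡⟨ sum-cong-≗ (toMultiset-∪⁅⁆ x∉R) ⟩
    ∑ (λ i → toMultiset R i + toMultiset ⁅ x ⁆ i)    ≡⟨ ∑-distrib-+ (toMultiset R) _ ⟩
    ∑ (toMultiset R) + ∑ (toMultiset ⁅ x ⁆)          ≡⟨ cong₂ _+_ (∑-toMultiset R) (∑-toMultiset-⁅⁆ x) ⟩
    ∣ R ∣ + 1                                        ∎
    where open ≡-Reasoning

  symDiff-∪⁅⁆ : ∀ {x y} → x ∉ R → y ∉ R → x ≢ y →
    symDiff (toMultiset (R ∪ ⁅ x ⁆)) (toMultiset (R ∪ ⁅ y ⁆)) ≡ 2
  symDiff-∪⁅⁆ {x} {y} x∉R y∉R x≢y = begin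
    symDiff (toMultiset (R ∪ ⁅ x ⁆)) (toMultiset (R ∪ ⁅ y ⁆))         ≡⟨ sum-map-allFin {k} _ ⟩
    ∑ (λ i → ∣ toMultiset (R ∪ ⁅ x ⁆) i - toMultiset (R ∪ ⁅ y ⁆) i ∣) ≡⟨ sum-cong-≗ pointwise ⟩
    ∑ (λ i → toMultiset ⁅ x ⁆ i + toMultiset ⁅ y ⁆ i)                 ≡⟨ ∑-distrib-+ (toMultiset ⁅ x ⁆) _ ⟩
    ∑ (toMultiset ⁅ x ⁆) + ∑ (toMultiset ⁅ y ⁆)                       ≡⟨ cong₂ _+_ (∑-toMultiset-⁅⁆ x) (∑-toMultiset-⁅⁆ y) ⟩
    2                                                                 ∎
    where
    open ≡-Reasoning
    pointwise : ∀ i → ∣ toMultiset (R ∪ ⁅ x ⁆) i - toMultiset (R ∪ ⁅ y ⁆) i ∣ ≡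
                      toMultiset ⁅ x ⁆ i + toMultiset ⁅ y ⁆ i
    pointwise i rewrite toMultiset-∪⁅⁆ x∉R i | toMultiset-∪⁅⁆ y∉R i
                      | ∣m+n-m+o∣≡∣n-o∣ (toMultiset R i) (toMultiset ⁅ x ⁆ i) (toMultiset ⁅ y ⁆ i)
      with i ≟ x
    ... | yes refl rewrite toMultiset-∈ (x∈⁅x⁆ i) | toMultiset-∉ (x≢y⇒x∉⁅y⁆ x≢y) = refl
    ... | no i≢x   rewrite toMultiset-∉ (x≢y⇒x∉⁅y⁆ i≢x) = ∣-∣-identityˡ _

  InU⇒≡∪⁅⁆ : ∀ {S} → InU R S → ∃ λ x → x ∉ R × S ≡ R ∪ ⁅ x ⁆
  InU⇒≡∪⁅⁆ {S} ((R⊆S , x , x∈S , x∉R) , ∣S∣≡∣R∣+1) = x , x∉R , ⊆-antisym S⊆R∪x R∪x⊆S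
    where
    R∪x⊆S : R ∪ ⁅ x ⁆ ⊆ S
    R∪x⊆S i∈R∪x with x∈p∪q⁻ R ⁅ x ⁆ i∈R∪x
    ... | inj₁ i∈R = R⊆S i∈R
    ... | inj₂ i∈x rewrite x∈⁅y⁆⇒x≡y x i∈x = x∈S
    R⊂R∪x : R ⊂ R ∪ ⁅ x ⁆
    R⊂R∪x = p⊆p∪q ⁅ x ⁆ , x , x∈p∪q⁺ (inj₂ (x∈⁅x⁆ x)) , x∉R
    -- An element of S outside R ∪ ⁅ x ⁆ would make S two larger than R.
    S⊆R∪x : S ⊆ R ∪ ⁅ x ⁆
    S⊆R∪x {i} i∈S with i ∈? R ∪ ⁅ x ⁆
    ... | yes i∈R∪x = i∈R∪x
    ... | no  i∉R∪x = contradiction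
      (subst (suc (suc ∣ R ∣) ≤_) (trans ∣S∣≡∣R∣+1 (+-comm ∣ R ∣ 1))
        (<-≤-trans (s≤s (p⊂q⇒∣p∣<∣q∣ R⊂R∪x)) (p⊂q⇒∣p∣<∣q∣ (R∪x⊆S , i , i∈S , i∉R∪x))))
      (n≮n (suc ∣ R ∣))

x∉p∖x : ∀ {k} {p : Subset k} x → x ∉ p ∖ x
x∉p∖x {p = _ Vec.∷ _} zero    ()
x∉p∖x {p = _ Vec.∷ _} (suc x) (there x∈p∖x) = x∉p∖x x x∈p∖x

x∈p∖y⇒x≢y : ∀ {k} {p : Subset k} {x y} → x ∈ p ∖ y → x ≢ y
x∈p∖y⇒x≢y {x = x} x∈p∖y refl = x∉p∖x x x∈p∖y

suc∣p∖x∣≡∣p∣ : ∀ {k} {p : Subset k} {x} → x ∈ p → suc ∣ p ∖ x ∣ ≡ ∣ p ∣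
suc∣p∖x∣≡∣p∣ {p = inside  Vec.∷ p} here = cong (suc ∘ ∣_∣) (p─⊥≡p p)
suc∣p∖x∣≡∣p∣ {p = inside  Vec.∷ p} (there x∈p) = cong suc (suc∣p∖x∣≡∣p∣ x∈p)
suc∣p∖x∣≡∣p∣ {p = outside Vec.∷ p} (there x∈p) = suc∣p∖x∣≡∣p∣ x∈p

pattern distinct₃ d₁₂ d₁₃ d₂₃ = (d₁₂ ∷ d₁₃ ∷ []) ∷ (d₂₃ ∷ []) ∷ [] ∷ []
pattern distinct₄ d₁₂ d₁₃ d₁₄ d₂₃ d₂₄ d₃₄ =
  (d₁₂ ∷ d₁₃ ∷ d₁₄ ∷ []) ∷ (d₂₃ ∷ d₂₄ ∷ []) ∷ (d₃₄ ∷ []) ∷ [] ∷ []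

module NearbyArrangements {K N : ℕ} (R : Subset K) (σ : Fin K → Fin N → Fin K)
  (σ-injective  : ∀ {x} → x ∉ R → ∀ {i j} → σ x i ≡ σ x j → i ≡ j)
  (σ-∈          : ∀ {x} → x ∉ R → ∀ j → σ x j ∈ R ⊎ σ x j ≡ x)
  (σ-surjective : ∀ {x ℓ} → x ∉ R → ℓ ∈ R ⊎ ℓ ≡ x → ∃ λ j → σ x j ≡ ℓ)
  (σ-close      : ∀ {x y} → x ∉ R → y ∉ R → x ≢ y → ∀ {js} → Unique js →
                  All (λ j → σ x j ≢ σ y j) js → length js ≤ 3)
  where

  InjectiveOn : (Fin K → Fin N) → Set
  InjectiveOn f = ∀ {r s} → r ∈ R → s ∈ R → f r ≡ f s → r ≡ s

  AllButTwoFixed : Set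
  AllButTwoFixed = Σ (Fin K) λ a → Σ (Fin K) λ b → Σ (Fin K → Fin N) λ g →
    a ∈ R × b ∈ R × a ≢ b × InjectiveOn g ×
    (∀ {c} → c ∈ R → c ≢ a → c ≢ b → ∀ {u} → u ∉ R → σ u (g c) ≡ c)

  FixedOrAtSpare : Set
  FixedOrAtSpare = Σ (Fin K → Fin N) λ h → Σ (Fin N) λ w →
    InjectiveOn h × (∀ {r} → r ∈ R → h r ≢ w) ×
    (∀ {r} → r ∈ R → ∀ {u} → u ∉ R → σ u (h r) ≡ r ⊎ σ u w ≡ r)

  ∈-∉-≢ : ∀ {r x} → r ∈ R → x ∉ R → r ≢ x
  ∈-∉-≢ r∈R x∉R refl = x∉R r∈R

  unique-position : ∀ {x i j ℓ} → x ∉ R → σ x i ≡ ℓ → σ x j ≡ ℓ → i ≡ j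
  unique-position x∉R σxi≡ℓ σxj≡ℓ = σ-injective x∉R (trans σxi≡ℓ (sym σxj≡ℓ))

  σ-omits : ∀ {x y j} → x ∉ R → y ∉ R → y ≢ x → σ y j ≢ x
  σ-omits {j = j} x∉R y∉R y≢x σyj≡x with σ-∈ y∉R j
  ... | inj₁ σyj∈R = x∉R (subst (_∈ R) σyj≡x σyj∈R)
  ... | inj₂ σyj≡y = y≢x (trans (sym σyj≡y) σyj≡x)

  disagree : ∀ {x y i ℓ} → σ x i ≢ ℓ → σ y i ≡ ℓ → σ x i ≢ σ y i
  disagree σxi≢ℓ σyi≡ℓ σxi≡σyi = σxi≢ℓ (trans σxi≡σyi σyi≡ℓ)

  four-disagreements : ∀ {x y i₁ i₂ i₃ i₄} → x ∉ R → y ∉ R → x ≢ y →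
    Unique (i₁ ∷ i₂ ∷ i₃ ∷ i₄ ∷ []) →
    σ x i₁ ≢ σ y i₁ → σ x i₂ ≢ σ y i₂ → σ x i₃ ≢ σ y i₃ → σ x i₄ ≢ σ y i₄ → ⊥
  four-disagreements x∉R y∉R x≢y distinct d₁ d₂ d₃ d₄ =
    contradiction (σ-close x∉R y∉R x≢y distinct (d₁ ∷ d₂ ∷ d₃ ∷ d₄ ∷ []))
      λ { (s≤s (s≤s (s≤s ()))) }

  agree-elsewhere : ∀ {x y i₁ i₂ i₃} → x ∉ R → y ∉ R → x ≢ y → Unique (i₁ ∷ i₂ ∷ i₃ ∷ []) →
    σ x i₁ ≢ σ y i₁ → σ x i₂ ≢ σ y i₂ → σ x i₃ ≢ σ y i₃ →
    ∀ j → j ≢ i₁ → j ≢ i₂ → j ≢ i₃ → σ x j ≡ σ y j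
  agree-elsewhere {x} {y} x∉R y∉R x≢y distinct d₁ d₂ d₃ j j≢i₁ j≢i₂ j≢i₃ with σ x j ≟ σ y j
  ... | yes agree = agree
  ... | no  d     =
    contradiction d₃ (four-disagreements x∉R y∉R x≢y ((j≢i₁ ∷ j≢i₂ ∷ j≢i₃ ∷ []) ∷ distinct) d d₁ d₂)

  agree-at-one-of : ∀ {x y i₁ i₂ i₃ i₄ ℓ₁ ℓ₂} → x ∉ R → y ∉ R → x ≢ y →
    Unique (i₁ ∷ i₂ ∷ i₃ ∷ i₄ ∷ []) → σ y i₁ ≡ ℓ₁ → σ y i₂ ≡ ℓ₂ →
    σ x i₃ ≢ σ y i₃ → σ x i₄ ≢ σ y i₄ → σ x i₁ ≡ ℓ₁ ⊎ σ x i₂ ≡ ℓ₂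
  agree-at-one-of {x} {y} {i₁} {i₂} x∉R y∉R x≢y distinct σyi₁≡ℓ₁ σyi₂≡ℓ₂ d₃ d₄
    with σ x i₁ ≟ σ y i₁ | σ x i₂ ≟ σ y i₂
  ... | yes agree | _         = inj₁ (trans agree σyi₁≡ℓ₁)
  ... | no _      | yes agree = inj₂ (trans agree σyi₂≡ℓ₂)
  ... | no d₁     | no d₂     = contradiction d₄ (four-disagreements x∉R y∉R x≢y distinct d₁ d₂ d₃)

  located : ∀ {x y i₁ i₂ i₃ ℓ} → x ∉ R → ℓ ∈ R ⊎ ℓ ≡ x →
    (∀ j → j ≢ i₁ → j ≢ i₂ → j ≢ i₃ → σ x j ≡ σ y j) →
    σ x i₁ ≡ ℓ ⊎ σ x i₂ ≡ ℓ ⊎ σ x i₃ ≡ ℓ ⊎ ∃ λ j → σ x j ≡ ℓ × σ y j ≡ ℓ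
  located {i₁ = i₁} {i₂} {i₃} x∉R ℓ-occurs agree with σ-surjective x∉R ℓ-occurs
  ... | j , σxj≡ℓ with j ≟ i₁ | j ≟ i₂ | j ≟ i₃
  ... | yes refl  | _         | _         = inj₁ σxj≡ℓ
  ... | no _      | yes refl  | _         = inj₂ (inj₁ σxj≡ℓ)
  ... | no _      | no _      | yes refl  = inj₂ (inj₂ (inj₁ σxj≡ℓ))
  ... | no j≢i₁   | no j≢i₂   | no j≢i₃   =
    inj₂ (inj₂ (inj₂ (j , σxj≡ℓ , trans (sym (agree j j≢i₁ j≢i₂ j≢i₃)) σxj≡ℓ)))

  module Reference {x₀} (x₀∉R : x₀ ∉ R) where

    σ₀ : Fin N → Fin K
    σ₀ = σ x₀

    spare : Fin N
    spare = proj₁ (σ-surjective x₀∉R (inj₂ refl))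

    σ₀-spare : σ₀ spare ≡ x₀
    σ₀-spare = proj₂ (σ-surjective x₀∉R (inj₂ refl))

    -- Outside R the value of pos is junk; only its values on R are used.
    pos : Fin K → Fin N
    pos ℓ with any? (λ j → σ₀ j ≟ ℓ)
    ... | yes (j , _) = j
    ... | no  _       = spare

    σ₀-pos : ∀ {r} → r ∈ R → σ₀ (pos r) ≡ r
    σ₀-pos {r} r∈R with any? (λ j → σ₀ j ≟ r)
    ... | yes (_ , σ₀j≡r) = σ₀j≡r
    ... | no  absent      = contradiction (σ-surjective x₀∉R (inj₁ r∈R)) absent

    σ₀⇒pos : ∀ {r j} → r ∈ R → σ₀ j ≡ r → j ≡ pos r
    σ₀⇒pos r∈R σ₀j≡r = unique-position x₀∉R σ₀j≡r (σ₀-pos r∈R)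

    pos-injective : InjectiveOn pos
    pos-injective r∈R s∈R pr≡ps = trans (sym (σ₀-pos r∈R)) (trans (cong σ₀ pr≡ps) (σ₀-pos s∈R))

    pos≢pos : ∀ {r s} → r ∈ R → s ∈ R → r ≢ s → pos r ≢ pos s
    pos≢pos r∈R s∈R r≢s pr≡ps = r≢s (pos-injective r∈R s∈R pr≡ps)

    pos≢spare : ∀ {r} → r ∈ R → pos r ≢ spare
    pos≢spare r∈R pr≡spare =
      ∈-∉-≢ r∈R x₀∉R (trans (sym (σ₀-pos r∈R)) (trans (cong σ₀ pr≡spare) σ₀-spare))

    σ₀-position : ∀ j → j ≡ spare ⊎ ∃ λ e → e ∈ R × j ≡ pos e
    σ₀-position j with σ-∈ x₀∉R j
    ... | inj₁ σ₀j∈R = inj₂ (σ₀ j , σ₀j∈R , σ₀⇒pos σ₀j∈R refl)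
    ... | inj₂ σ₀j≡x₀ = inj₁ (unique-position x₀∉R σ₀j≡x₀ σ₀-spare)

    spare-moved : ∀ {u} → u ∉ R → u ≢ x₀ → σ u spare ≢ σ₀ spare
    spare-moved u∉R u≢x₀ = disagree (σ-omits x₀∉R u∉R u≢x₀) σ₀-spare

    Misplaces : Fin K → Fin K → Set
    Misplaces u r = σ u (pos r) ≢ r

    misplaces⇒≢x₀ : ∀ {u r} → r ∈ R → Misplaces u r → u ≢ x₀
    misplaces⇒≢x₀ r∈R misplaced refl = misplaced (σ₀-pos r∈R)

    TwoMisplaced : Set
    TwoMisplaced = Σ (Fin K) λ u → Σ (Fin K) λ a → Σ (Fin K) λ b →
      u ∉ R × a ∈ R × b ∈ R × a ≢ b × Misplaces u a × Misplaces u b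

    twoMisplaced? : Dec TwoMisplaced
    twoMisplaced? = any? λ u → any? λ a → any? λ b →
      ¬? (u ∈? R) ×-dec a ∈? R ×-dec b ∈? R ×-dec ¬? (a ≟ b) ×-dec
      ¬? (σ u (pos a) ≟ a) ×-dec ¬? (σ u (pos b) ≟ b)

    -- A misplaced letter r sits either at the spare position or at pos e of
    -- some other letter e, which is then misplaced as well.
    ¬twoMisplaced⇒fixedOrAtSpare : ¬ TwoMisplaced → FixedOrAtSpare
    ¬twoMisplaced⇒fixedOrAtSpare noTwo = pos , spare , pos-injective , pos≢spare , placement
      where
      placement : ∀ {r} → r ∈ R → ∀ {u} → u ∉ R → σ u (pos r) ≡ r ⊎ σ u spare ≡ r
      placement {r} r∈R {u} u∉R with σ u (pos r) ≟ r
      ... | yes fixed = inj₁ fixed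
      ... | no r-misplaced with σ-surjective u∉R (inj₁ r∈R)
      ... | j , σuj≡r with σ₀-position j
      ... | inj₁ refl = inj₂ σuj≡r
      ... | inj₂ (e , e∈R , refl) =
        contradiction (u , r , e , u∉R , r∈R , e∈R , r≢e , r-misplaced , e-misplaced) noTwo
        where
        r≢e : r ≢ e
        r≢e refl = r-misplaced σuj≡r
        e-misplaced : Misplaces u e
        e-misplaced σue≡e = r≢e (trans (sym σuj≡r) σue≡e)

    -- Otherwise r would sit at pos e for a third letter e, and u would differ
    -- from x₀ at the spare position, pos a, pos r and pos e.
    spare-taken : ∀ {u a r} → u ∉ R → a ∈ R → r ∈ R → r ≢ a → σ u spare ≡ a →
      σ u (pos r) ≡ r ⊎ σ u (pos a) ≡ r
    spare-taken {u} {a} {r} u∉R a∈R r∈R r≢a σu-spare≡a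
      with σ u (pos r) ≟ r | σ u (pos a) ≟ r
    ... | yes fixed      | _           = inj₁ fixed
    ... | no _           | yes at-pos-a = inj₂ at-pos-a
    ... | no r-misplaced | no r-not-at-pos-a with σ-surjective u∉R (inj₁ r∈R)
    ... | j , σuj≡r with σ₀-position j
    ... | inj₁ refl = contradiction (trans (sym σu-spare≡a) σuj≡r) (≢-sym r≢a)
    ... | inj₂ (e , e∈R , refl) = ⊥-elim $
      four-disagreements u∉R x₀∉R u≢x₀
        (distinct₄ (≢-sym (pos≢spare a∈R)) (≢-sym (pos≢spare r∈R)) (≢-sym (pos≢spare e∈R))
                   (pos≢pos a∈R r∈R (≢-sym r≢a)) (pos≢pos a∈R e∈R a≢e) (pos≢pos r∈R e∈R r≢e))
        (spare-moved u∉R u≢x₀)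
        (disagree (λ σu-pos-a≡a → pos≢spare a∈R (unique-position u∉R σu-pos-a≡a σu-spare≡a))
                  (σ₀-pos a∈R))
        (disagree r-misplaced (σ₀-pos r∈R))
        (disagree (λ σue≡e → r≢e (trans (sym σuj≡r) σue≡e)) (σ₀-pos e∈R))
      where
      u≢x₀ : u ≢ x₀
      u≢x₀ = misplaces⇒≢x₀ r∈R r-misplaced
      r≢e : r ≢ e
      r≢e refl = r-misplaced σuj≡r
      a≢e : a ≢ e
      a≢e refl = r-not-at-pos-a σuj≡r

    module TwoMisplacedBy {y a b} (y∉R : y ∉ R) (a∈R : a ∈ R) (b∈R : b ∈ R) (a≢b : a ≢ b)
      (y-misplaces-a : Misplaces y a) (y-misplaces-b : Misplaces y b) where

      q s : Fin N
      q = pos a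
      s = pos b

      q≢spare : q ≢ spare
      q≢spare = pos≢spare a∈R

      s≢spare : s ≢ spare
      s≢spare = pos≢spare b∈R

      q≢s : q ≢ s
      q≢s = pos≢pos a∈R b∈R a≢b

      y≢x₀ : y ≢ x₀
      y≢x₀ = misplaces⇒≢x₀ a∈R y-misplaces-a

      y-agrees : ∀ j → j ≢ spare → j ≢ q → j ≢ s → σ y j ≡ σ₀ j
      y-agrees = agree-elsewhere y∉R x₀∉R y≢x₀ (distinct₃ (≢-sym q≢spare) (≢-sym s≢spare) q≢s)
        (spare-moved y∉R y≢x₀)
        (disagree y-misplaces-a (σ₀-pos a∈R))
        (disagree y-misplaces-b (σ₀-pos b∈R))

      y-fixes : ∀ {c} → c ∈ R → c ≢ a → c ≢ b → σ y (pos c) ≡ c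
      y-fixes c∈R c≢a c≢b =
        trans (y-agrees _ (pos≢spare c∈R) (pos≢pos c∈R a∈R c≢a) (pos≢pos c∈R b∈R c≢b)) (σ₀-pos c∈R)

      a-position : σ y spare ≡ a ⊎ σ y s ≡ a
      a-position with located y∉R (inj₁ a∈R) y-agrees
      ... | inj₁ at-spare                          = inj₁ at-spare
      ... | inj₂ (inj₁ at-q)                       = contradiction at-q y-misplaces-a
      ... | inj₂ (inj₂ (inj₁ at-s))                = inj₂ at-s
      ... | inj₂ (inj₂ (inj₂ (_ , σyj≡a , σ₀j≡a))) =
        contradiction (subst (λ i → σ y i ≡ a) (σ₀⇒pos a∈R σ₀j≡a) σyj≡a) y-misplaces-a

      y-position : σ y spare ≡ y ⊎ σ y q ≡ y ⊎ σ y s ≡ y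
      y-position with located y∉R (inj₂ refl) y-agrees
      ... | inj₁ at-spare                     = inj₁ at-spare
      ... | inj₂ (inj₁ at-q)                  = inj₂ (inj₁ at-q)
      ... | inj₂ (inj₂ (inj₁ at-s))           = inj₂ (inj₂ at-s)
      ... | inj₂ (inj₂ (inj₂ (_ , _ , σ₀j≡y))) = contradiction σ₀j≡y (σ-omits y∉R x₀∉R (≢-sym y≢x₀))

      module Swapped (y-s≡a : σ y s ≡ a) (y-q≡b : σ y q ≡ b) where

        y-spare≡y : σ y spare ≡ y
        y-spare≡y with y-position
        ... | inj₁ at-spare        = at-spare
        ... | inj₂ (inj₁ at-q)     = contradiction (trans (sym y-q≡b) at-q) (∈-∉-≢ b∈R y∉R)
        ... | inj₂ (inj₂ at-s)     = contradiction (trans (sym y-s≡a) at-s) (∈-∉-≢ a∈R y∉R)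

        -- A u misplacing c would agree with x₀ and with y at q or at s, but x₀
        -- and y show a and b there in opposite orders.
        never-misplaced : ∀ {c u} → c ∈ R → c ≢ a → c ≢ b → u ∉ R → ¬ Misplaces u c
        never-misplaced {c} {u} c∈R c≢a c≢b u∉R c-misplaced = incompatible
          (agree-at-one-of u∉R x₀∉R u≢x₀ distinct (σ₀-pos a∈R) (σ₀-pos b∈R)
            (spare-moved u∉R u≢x₀) (disagree c-misplaced (σ₀-pos c∈R)))
          (agree-at-one-of u∉R y∉R u≢y distinct y-q≡b y-s≡a
            (disagree (σ-omits y∉R u∉R u≢y) y-spare≡y) (disagree c-misplaced (y-fixes c∈R c≢a c≢b)))
          where
          u≢x₀ : u ≢ x₀
          u≢x₀ = misplaces⇒≢x₀ c∈R c-misplaced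
          u≢y : u ≢ y
          u≢y refl = c-misplaced (y-fixes c∈R c≢a c≢b)
          distinct : Unique (q ∷ s ∷ spare ∷ pos c ∷ [])
          distinct = distinct₄ q≢s q≢spare (pos≢pos a∈R c∈R (≢-sym c≢a))
                               s≢spare (pos≢pos b∈R c∈R (≢-sym c≢b)) (≢-sym (pos≢spare c∈R))
          incompatible : σ u q ≡ a ⊎ σ u s ≡ b → σ u q ≡ b ⊎ σ u s ≡ a → ⊥
          incompatible (inj₁ q↦a) (inj₁ q↦b) = a≢b (trans (sym q↦a) q↦b)
          incompatible (inj₁ q↦a) (inj₂ s↦a) = q≢s (unique-position u∉R q↦a s↦a)
          incompatible (inj₂ s↦b) (inj₁ q↦b) = q≢s (unique-position u∉R q↦b s↦b)
          incompatible (inj₂ s↦b) (inj₂ s↦a) = a≢b (trans (sym s↦a) s↦b)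

        allButTwoFixed : AllButTwoFixed
        allButTwoFixed = a , b , pos , a∈R , b∈R , a≢b , pos-injective ,
          λ c∈R c≢a c≢b u∉R →
            decidable-stable (_ ≟ _) (never-misplaced c∈R c≢a c≢b u∉R)

      module Cycle (y-spare≡a : σ y spare ≡ a) (y-q≡b : σ y q ≡ b) where

        y-s≡y : σ y s ≡ y
        y-s≡y with y-position
        ... | inj₁ at-spare    = contradiction (trans (sym y-spare≡a) at-spare) (∈-∉-≢ a∈R y∉R)
        ... | inj₂ (inj₁ at-q) = contradiction (trans (sym y-q≡b) at-q) (∈-∉-≢ b∈R y∉R)
        ... | inj₂ (inj₂ at-s) = at-s

        ThirdMisplaced : Set
        ThirdMisplaced = Σ (Fin K) λ z → Σ (Fin K) λ c →
          z ∉ R × c ∈ R × c ≢ a × c ≢ b × Misplaces z c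

        thirdMisplaced? : Dec ThirdMisplaced
        thirdMisplaced? = any? λ z → any? λ c →
          ¬? (z ∈? R) ×-dec c ∈? R ×-dec ¬? (c ≟ a) ×-dec ¬? (c ≟ b) ×-dec ¬? (σ z (pos c) ≟ c)

        module ThirdMisplacedBy {z c} (z∉R : z ∉ R) (c∈R : c ∈ R) (c≢a : c ≢ a) (c≢b : c ≢ b)
          (z-misplaces-c : Misplaces z c) where

          t : Fin N
          t = pos c

          t≢spare : t ≢ spare
          t≢spare = pos≢spare c∈R

          t≢q : t ≢ q
          t≢q = pos≢pos c∈R a∈R c≢a

          t≢s : t ≢ s
          t≢s = pos≢pos c∈R b∈R c≢b

          z≢x₀ : z ≢ x₀
          z≢x₀ = misplaces⇒≢x₀ c∈R z-misplaces-c

          z≢y : z ≢ y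
          z≢y refl = z-misplaces-c (y-fixes c∈R c≢a c≢b)

          z-spare≡a×z-s≡b : σ z spare ≡ a × σ z s ≡ b
          z-spare≡a×z-s≡b = combine
            (agree-at-one-of z∉R y∉R z≢y
              (distinct₄ (≢-sym q≢spare) (≢-sym s≢spare) (≢-sym t≢spare) q≢s (≢-sym t≢q) (≢-sym t≢s))
              y-spare≡a y-q≡b
              (disagree (σ-omits y∉R z∉R z≢y) y-s≡y) (disagree z-misplaces-c (y-fixes c∈R c≢a c≢b)))
            (agree-at-one-of z∉R x₀∉R z≢x₀
              (distinct₄ q≢s q≢spare (≢-sym t≢q) s≢spare (≢-sym t≢s) (≢-sym t≢spare))
              (σ₀-pos a∈R) (σ₀-pos b∈R)
              (spare-moved z∉R z≢x₀) (disagree z-misplaces-c (σ₀-pos c∈R)))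
            where
            combine : σ z spare ≡ a ⊎ σ z q ≡ b → σ z q ≡ a ⊎ σ z s ≡ b → σ z spare ≡ a × σ z s ≡ b
            combine (inj₁ spare↦a) (inj₂ s↦b) = spare↦a , s↦b
            combine (inj₁ spare↦a) (inj₁ q↦a) = ⊥-elim (q≢spare (unique-position z∉R q↦a spare↦a))
            combine (inj₂ q↦b)     (inj₁ q↦a) = ⊥-elim (a≢b (trans (sym q↦a) q↦b))
            combine (inj₂ q↦b)     (inj₂ s↦b) = ⊥-elim (q≢s (unique-position z∉R q↦b s↦b))

          z-spare≡a : σ z spare ≡ a
          z-spare≡a = proj₁ z-spare≡a×z-s≡b

          z-s≡b : σ z s ≡ b
          z-s≡b = proj₂ z-spare≡a×z-s≡b

          z-agrees : ∀ j → j ≢ spare → j ≢ q → j ≢ t → σ z j ≡ σ₀ j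
          z-agrees = agree-elsewhere z∉R x₀∉R z≢x₀ (distinct₃ (≢-sym q≢spare) (≢-sym t≢spare) (≢-sym t≢q))
            (spare-moved z∉R z≢x₀)
            (disagree (λ q↦a → q≢spare (unique-position z∉R q↦a z-spare≡a)) (σ₀-pos a∈R))
            (disagree z-misplaces-c (σ₀-pos c∈R))

          z-q≡c : σ z q ≡ c
          z-q≡c with located z∉R (inj₁ c∈R) z-agrees
          ... | inj₁ at-spare                          = contradiction (trans (sym z-spare≡a) at-spare) (≢-sym c≢a)
          ... | inj₂ (inj₁ at-q)                       = at-q
          ... | inj₂ (inj₂ (inj₁ at-t))                = contradiction at-t z-misplaces-c
          ... | inj₂ (inj₂ (inj₂ (_ , σzj≡c , σ₀j≡c))) =
            contradiction (subst (λ i → σ z i ≡ c) (σ₀⇒pos c∈R σ₀j≡c) σzj≡c) z-misplaces-c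

          z-t≡z : σ z t ≡ z
          z-t≡z with located z∉R (inj₂ refl) z-agrees
          ... | inj₁ at-spare                     = contradiction (trans (sym z-spare≡a) at-spare) (∈-∉-≢ a∈R z∉R)
          ... | inj₂ (inj₁ at-q)                  = contradiction (trans (sym z-q≡c) at-q) (∈-∉-≢ c∈R z∉R)
          ... | inj₂ (inj₂ (inj₁ at-t))           = at-t
          ... | inj₂ (inj₂ (inj₂ (_ , _ , σ₀j≡z))) = contradiction σ₀j≡z (σ-omits z∉R x₀∉R (≢-sym z≢x₀))

          module FollowsY {u} (u∉R : u ∉ R) (u-spare≢a : σ u spare ≢ a) where

            u≢y : u ≢ y
            u≢y refl = u-spare≢a y-spare≡a

            u≢z : u ≢ z
            u≢z refl = u-spare≢a z-spare≡a

            u-s≡b : σ u s ≡ b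
            u-s≡b = combine
              (agree-at-one-of u∉R y∉R u≢y
                (distinct₄ (≢-sym t≢q) q≢spare q≢s t≢spare t≢s (≢-sym s≢spare))
                y-q≡b (y-fixes c∈R c≢a c≢b)
                (disagree u-spare≢a y-spare≡a) (disagree (σ-omits y∉R u∉R u≢y) y-s≡y))
              (agree-at-one-of u∉R z∉R u≢z
                (distinct₄ q≢s q≢spare (≢-sym t≢q) s≢spare (≢-sym t≢s) (≢-sym t≢spare))
                z-q≡c z-s≡b
                (disagree u-spare≢a z-spare≡a) (disagree (σ-omits z∉R u∉R u≢z) z-t≡z))
              where
              combine : σ u q ≡ b ⊎ σ u t ≡ c → σ u q ≡ c ⊎ σ u s ≡ b → σ u s ≡ b
              combine _          (inj₂ s↦b) = s↦b
              combine (inj₁ q↦b) (inj₁ q↦c) = ⊥-elim (c≢b (trans (sym q↦c) q↦b))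
              combine (inj₂ t↦c) (inj₁ q↦c) = ⊥-elim (t≢q (unique-position u∉R t↦c q↦c))

            u-agrees : ∀ j → j ≢ spare → j ≢ q → j ≢ s → σ u j ≡ σ y j
            u-agrees = agree-elsewhere u∉R y∉R u≢y (distinct₃ (≢-sym q≢spare) (≢-sym s≢spare) q≢s)
              (disagree u-spare≢a y-spare≡a)
              (disagree (λ q↦b → q≢s (unique-position u∉R q↦b u-s≡b)) y-q≡b)
              (disagree (σ-omits y∉R u∉R u≢y) y-s≡y)

            u-q≡a : σ u q ≡ a
            u-q≡a with located u∉R (inj₁ a∈R) u-agrees
            ... | inj₁ at-spare                          = contradiction at-spare u-spare≢a
            ... | inj₂ (inj₁ at-q)                       = at-q
            ... | inj₂ (inj₂ (inj₁ at-s))                = contradiction (trans (sym u-s≡b) at-s) (≢-sym a≢b)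
            ... | inj₂ (inj₂ (inj₂ (_ , σuj≡a , σyj≡a))) =
              contradiction (subst (λ i → σ u i ≡ a) (unique-position y∉R σyj≡a y-spare≡a) σuj≡a) u-spare≢a

            u-fixes : ∀ {r} → r ∈ R → r ≢ a → r ≢ b → σ u (pos r) ≡ r
            u-fixes r∈R r≢a r≢b =
              trans (u-agrees _ (pos≢spare r∈R) (pos≢pos r∈R a∈R r≢a) (pos≢pos r∈R b∈R r≢b))
                    (y-fixes r∈R r≢a r≢b)

          h : Fin K → Fin N
          h r with r ≟ a
          ... | yes _ = spare
          ... | no  _ = pos r

          h-injective : InjectiveOn h
          h-injective {r} {r′} r∈R r′∈R hr≡hr′ with r ≟ a | r′ ≟ a
          ... | yes refl | yes refl = refl
          ... | yes refl | no  _    = contradiction (sym hr≡hr′) (pos≢spare r′∈R)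
          ... | no  _    | yes refl = contradiction hr≡hr′ (pos≢spare r∈R)
          ... | no  _    | no  _    = pos-injective r∈R r′∈R hr≡hr′

          h≢q : ∀ {r} → r ∈ R → h r ≢ q
          h≢q {r} r∈R with r ≟ a
          ... | yes _   = ≢-sym q≢spare
          ... | no  r≢a = pos≢pos r∈R a∈R r≢a

          placement : ∀ {r} → r ∈ R → ∀ {u} → u ∉ R → σ u (h r) ≡ r ⊎ σ u q ≡ r
          placement {r} r∈R {u} u∉R with r ≟ a | σ u spare ≟ a
          ... | yes refl | yes u-spare≡a = inj₁ u-spare≡a
          ... | no  r≢a  | yes u-spare≡a = spare-taken u∉R a∈R r∈R r≢a u-spare≡a
          ... | yes refl | no u-spare≢a = inj₂ (FollowsY.u-q≡a u∉R u-spare≢a)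
          ... | no  r≢a  | no u-spare≢a with r ≟ b
          ...   | yes refl = inj₁ (FollowsY.u-s≡b u∉R u-spare≢a)
          ...   | no  r≢b  = inj₁ (FollowsY.u-fixes u∉R u-spare≢a r∈R r≢a r≢b)

          fixedOrAtSpare : FixedOrAtSpare
          fixedOrAtSpare = h , q , h-injective , h≢q , placement

        dichotomy : AllButTwoFixed ⊎ FixedOrAtSpare
        dichotomy with thirdMisplaced?
        ... | yes (_ , _ , z∉R , c∈R , c≢a , c≢b , z-misplaces-c) =
          inj₂ (ThirdMisplacedBy.fixedOrAtSpare z∉R c∈R c≢a c≢b z-misplaces-c)
        ... | no noThird = inj₁ (a , b , pos , a∈R , b∈R , a≢b , pos-injective ,
          λ c∈R c≢a c≢b u∉R → decidable-stable (_ ≟ _)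
            λ c-misplaced → noThird (_ , _ , u∉R , c∈R , c≢a , c≢b , c-misplaced))

    fromTwoMisplaced : TwoMisplaced → AllButTwoFixed ⊎ FixedOrAtSpare
    fromTwoMisplaced (y , a , b , y∉R , a∈R , b∈R , a≢b , y-misplaces-a , y-misplaces-b) =
      shape AB.a-position BA.a-position
      where
      module AB = TwoMisplacedBy y∉R a∈R b∈R a≢b y-misplaces-a y-misplaces-b
      module BA = TwoMisplacedBy y∉R b∈R a∈R (≢-sym a≢b) y-misplaces-b y-misplaces-a
      shape : σ y spare ≡ a ⊎ σ y (pos b) ≡ a → σ y spare ≡ b ⊎ σ y (pos a) ≡ b →
              AllButTwoFixed ⊎ FixedOrAtSpare
      shape (inj₁ spare↦a) (inj₁ spare↦b) = ⊥-elim (a≢b (trans (sym spare↦a) spare↦b))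
      shape (inj₁ spare↦a) (inj₂ q↦b)     = AB.Cycle.dichotomy spare↦a q↦b
      shape (inj₂ s↦a)     (inj₁ spare↦b) = BA.Cycle.dichotomy spare↦b s↦a
      shape (inj₂ s↦a)     (inj₂ q↦b)     = inj₁ (AB.Swapped.allButTwoFixed s↦a q↦b)

    dichotomy : AllButTwoFixed ⊎ FixedOrAtSpare
    dichotomy with twoMisplaced?
    ... | yes two  = fromTwoMisplaced two
    ... | no noTwo = inj₂ (¬twoMisplaced⇒fixedOrAtSpare noTwo)

Alternative₁ : ∀ {N K} → (Multiset K → String N K) → Subset K → Set
Alternative₁ {N} {K} π R = Σ (Subset K) λ A → Σ (Fin K → Fin N) λ g →
    A ⊂ R × ∣ A ∣ + 3 ≡ N
  × (∀ a b → a ∈ A → b ∈ A → g a ≡ g b → a ≡ b)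
  × (∀ a → a ∈ A → ∀ S → InU R S → π (toMultiset S) (g a) ≡ a)

Alternative₂ : ∀ {N K} → (Multiset K → String N K) → Subset K → Set
Alternative₂ {N} {K} π R = Σ (Fin K → Fin N) λ h → Σ (Fin N) λ w →
    (∀ r s → r ∈ R → s ∈ R → h r ≡ h s → r ≡ s)
  × (∀ r → r ∈ R → h r ≢ w)
  × (∀ r → r ∈ R → ∀ S → InU R S → (π (toMultiset S) (h r) ≡ r) ⊎ (π (toMultiset S) w ≡ r))

∈∖∖ : ∀ {k} {R : Subset k} {a b x} → x ∈ R ∖ a ∖ b → x ∈ R × x ≢ a × x ≢ b
∈∖∖ {R = R} {a} {b} x∈R∖a∖b =
  p─q⊆p R ⁅ a ⁆ x∈R∖a , x∈p∖y⇒x≢y x∈R∖a , x∈p∖y⇒x≢y x∈R∖a∖b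
  where x∈R∖a = p─q⊆p (R ∖ a) ⁅ b ⁆ x∈R∖a∖b

module Realisation {n k} (π : Multiset (suc k) → String (suc n) (suc k))
  (assignment : IsAssignment (suc n) (suc k) π)
  (distortion : MaxDistortionAtMost (suc n) (suc k) π 3)
  (R : Subset (suc k)) (∣R∣+1≡1+n : ∣ R ∣ + 1 ≡ suc n) where

  σ : Fin (suc k) → Fin (suc n) → Fin (suc k)
  σ x = π (toMultiset (R ∪ ⁅ x ⁆))

  size-∪⁅⁆≡1+n : ∀ {x} → x ∉ R → size (toMultiset (R ∪ ⁅ x ⁆)) ≡ suc n
  size-∪⁅⁆≡1+n x∉R = trans (size-∪⁅⁆ x∉R) ∣R∣+1≡1+n

  σ-perm : ∀ {x} → x ∉ R → IsPermOf (σ x) (toMultiset (R ∪ ⁅ x ⁆))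
  σ-perm {x} x∉R = assignment (toMultiset (R ∪ ⁅ x ⁆)) (size-∪⁅⁆≡1+n x∉R)

  σ-injective : ∀ {x} → x ∉ R → ∀ {i j} → σ x i ≡ σ x j → i ≡ j
  σ-injective {x} x∉R = perm-injective {X = σ x} {S = R ∪ ⁅ x ⁆} (σ-perm x∉R)

  σ-∈ : ∀ {x} → x ∉ R → ∀ j → σ x j ∈ R ⊎ σ x j ≡ x
  σ-∈ {x} x∉R j =
    Sum.map₂ (x∈⁅y⁆⇒x≡y x) (x∈p∪q⁻ R ⁅ x ⁆ (perm-∈ {X = σ x} {S = R ∪ ⁅ x ⁆} (σ-perm x∉R) j))

  σ-surjective : ∀ {x ℓ} → x ∉ R → ℓ ∈ R ⊎ ℓ ≡ x → ∃ λ j → σ x j ≡ ℓ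
  σ-surjective {x} x∉R ℓ∈R∪x =
    perm-surjective {X = σ x} {S = R ∪ ⁅ x ⁆} (σ-perm x∉R)
      (x∈p∪q⁺ (Sum.map₂ (λ { refl → x∈⁅x⁆ x }) ℓ∈R∪x))

  σ-close : ∀ {x y} → x ∉ R → y ∉ R → x ≢ y → ∀ {js} → Unique js →
            All (λ j → σ x j ≢ σ y j) js → length js ≤ 3
  σ-close {x} {y} x∉R y∉R x≢y distinct disagreements =
    ≤-trans (distinct≤count (λ j → ¬? (σ x j ≟ σ y j)) distinct disagreements)
            (distortion _ _ (size-∪⁅⁆≡1+n x∉R) (size-∪⁅⁆≡1+n y∉R) (symDiff-∪⁅⁆ x∉R y∉R x≢y))

  open NearbyArrangements R σ σ-injective σ-∈ σ-surjective σ-close public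

  every-InU : ∀ {P : String (suc n) (suc k) → Set} → (∀ {x} → x ∉ R → P (σ x)) →
    ∀ S → InU R S → P (π (toMultiset S))
  every-InU Pσ S S∈U with InU⇒≡∪⁅⁆ S∈U
  ... | x , x∉R , refl = Pσ x∉R

  toAlternative₁ : AllButTwoFixed → Alternative₁ π R
  toAlternative₁ (a , b , g , a∈R , b∈R , a≢b , g-injective , fixed) =
    R ∖ a ∖ b , g , (A⊆R , a , a∈R , λ a∈A → proj₁ (proj₂ (∈∖∖ a∈A)) refl) , card ,
    (λ c c′ c∈A c′∈A → g-injective (A⊆R c∈A) (A⊆R c′∈A)) ,
    (λ c c∈A → let c∈R , c≢a , c≢b = ∈∖∖ c∈A in
      every-InU {P = λ X → X (g c) ≡ c} (fixed c∈R c≢a c≢b))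
    where
    open ≡-Reasoning
    A⊆R : R ∖ a ∖ b ⊆ R
    A⊆R = proj₁ ∘ ∈∖∖
    card : ∣ R ∖ a ∖ b ∣ + 3 ≡ suc n
    card = begin
      ∣ R ∖ a ∖ b ∣ + 3           ≡⟨ +-comm ∣ R ∖ a ∖ b ∣ 3 ⟩
      suc (suc (suc ∣ R ∖ a ∖ b ∣)) ≡⟨ cong (2 +_) (suc∣p∖x∣≡∣p∣ (x∈p∧x≢y⇒x∈p∖y b∈R (a≢b ∘ sym))) ⟩
      suc (suc ∣ R ∖ a ∣)          ≡⟨ cong (1 +_) (suc∣p∖x∣≡∣p∣ a∈R) ⟩
      suc ∣ R ∣                    ≡⟨ +-comm 1 ∣ R ∣ ⟩
      ∣ R ∣ + 1                    ≡⟨ ∣R∣+1≡1+n ⟩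
      suc n                        ∎

  toAlternative₂ : FixedOrAtSpare → Alternative₂ π R
  toAlternative₂ (h , w , h-injective , h≢w , placement) =
    h , w , (λ r s → h-injective) , (λ r → h≢w) ,
    (λ r r∈R → every-InU {P = λ X → X (h r) ≡ r ⊎ X w ≡ r} (placement r∈R))

full⇒n≡1+k : ∀ {n k} {R : Subset (suc k)} → (∀ x → x ∈ R) → ∣ R ∣ + 1 ≡ suc n → n ≡ suc k
full⇒n≡1+k {n} {k} {R} full ∣R∣+1≡1+n =
  suc-injective (trans (sym ∣R∣+1≡1+n) (trans (cong (_+ 1) ∣R∣≡1+k) (+-comm (suc k) 1)))
  where
  ∣R∣≡1+k : ∣ R ∣ ≡ suc k
  ∣R∣≡1+k = ≤-antisym (∣p∣≤n R)
    (subst (_≤ ∣ R ∣) (∣⊤∣≡n (suc k)) (p⊆q⇒∣p∣≤∣q∣ {p = ⊤} (λ {x} _ → full x)))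

full⇒Alternative₂ : ∀ {n k} {π : Multiset (suc k) → String (suc n) (suc k)} {R : Subset (suc k)} →
  (∀ x → x ∈ R) → ∣ R ∣ + 1 ≡ suc n → Alternative₂ π R
full⇒Alternative₂ {k = k} full ∣R∣+1≡1+n with full⇒n≡1+k full ∣R∣+1≡1+n
... | refl = inject₁ , fromℕ (suc k) , (λ r s _ _ → inject₁-injective) , (λ r _ → fromℕ≢inject₁ ∘ sym) ,
  λ { r _ S ((_ , x , _ , x∉R) , _) → contradiction (full x) x∉R }

lemma3 : (n k : ℕ) → (π : Multiset (suc k) → String (suc n) (suc k)) →
  IsAssignment (suc n) (suc k) π →
  MaxDistortionAtMost (suc n) (suc k) π 3 →
  (R : Subset (suc k)) → ∣ R ∣ + 1 ≡ suc n →
  (Σ (Subset (suc k)) λ A → Σ (Fin (suc k) → Fin (suc n)) λ g →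
      A ⊂ R × ∣ A ∣ + 3 ≡ suc n
    × (∀ a b → a ∈ A → b ∈ A → g a ≡ g b → a ≡ b)
    × (∀ a → a ∈ A → ∀ S → InU R S → π (toMultiset S) (g a) ≡ a))
  ⊎
  (Σ (Fin (suc k) → Fin (suc n)) λ h → Σ (Fin (suc n)) λ w →
      (∀ r s → r ∈ R → s ∈ R → h r ≡ h s → r ≡ s)
    × (∀ r → r ∈ R → h r ≢ w)
    × (∀ r → r ∈ R → ∀ S → InU R S →
         (π (toMultiset S) (h r) ≡ r) ⊎ (π (toMultiset S) w ≡ r)))
lemma3 n k π assignment distortion R ∣R∣+1≡1+n with any? (λ x → ¬? (x ∈? R))
... | no  nothing-outside =
  inj₂ (full⇒Alternative₂ {π = π} (λ x → decidable-stable (x ∈? R) (nothing-outside ∘ (x ,_))) ∣R∣+1≡1+n)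
... | yes (x₀ , x₀∉R) = Sum.map toAlternative₁ toAlternative₂ (Reference.dichotomy x₀∉R)
  where open Realisation π assignment distortion R ∣R∣+1≡1+n
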